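{- Let $P(x)\in\mathbb{Z}[x]$ be a nonconstant polynomial of content $1$ with nonnegative coefficients. Let $(a,b)\in\mathbb{N}^2$. If $\gcd(b,\mathscr{L}_P(a))=1$, then \[ \frac{b\,P(t)}{P(a)}\notin\mathbb{Z}\quad\text{for all integers } 1\le t<a. \] Hence $(a,b)$ is $P$-visible.
   Context: $\mathbb{N}=\{1,2,3,\dots\}$. For fixed $a\in\mathbb{N}$ and $1\le t<a$, let $d_t=\dfrac{P(a)}{\gcd(P(a),P(t))}$ and $\mathscr{L}_P(a)=\operatorname{lcm}\{d_t:1\le t<a\}$ (with the convention that the lcm of the empty set is $1$). A point $(a,b)\in\mathbb{N}^2$ is called $P$-visible if no lattice point $(t,y)\in\mathbb{N}^2$ with $t<a$ lies on the curve $y=\frac{b}{P(a)}P(x)$, equivalently if $\frac{b\,P(t)}{P(a)}\notin\mathbb{Z}$ for all $1\le t<a$. -}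

module Defs where

open import Data.Nat using (ℕ; zero; suc; _+_; _*_; _<_; _≤_)
open import Data.Nat.Divisibility using (_∣_; quotient)
open import Data.Nat.GCD using (gcd; gcd[m,n]∣m)
open import Data.Nat.LCM using (lcm)
open import Data.List using (List; []; _∷_; foldr)
open import Data.Product using (∃; _×_)
open import Relation.Nullary using (¬_)

-- A polynomial with nonnegative integer coefficients, as its coefficient
-- list [c₀, c₁, …, c_d] (P(x) = Σ cᵢ xⁱ).
Poly : Set
Poly = List ℕ

eval : Poly → ℕ → ℕ
eval []       x = 0
eval (c ∷ cs) x = c + x * eval cs x

coeff : Poly → ℕ → ℕ
coeff []       i       = 0
coeff (c ∷ cs) zero    = c
coeff (c ∷ cs) (suc i) = coeff cs i

Nonconstant : Poly → Set
Nonconstant P = ∃ λ i → (1 ≤ i) × (0 < coeff P i)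

content : Poly → ℕ
content = foldr gcd 0

d : Poly → ℕ → ℕ → ℕ
d P a t = quotient (gcd[m,n]∣m (eval P a) (eval P t))

lcmUpTo : Poly → ℕ → ℕ → ℕ
lcmUpTo P a zero    = 1
lcmUpTo P a (suc k) = lcm (d P a (suc k)) (lcmUpTo P a k)

𝓛 : Poly → ℕ → ℕ
𝓛 P zero    = 1
𝓛 P (suc a) = lcmUpTo P (suc a) a

Visible : Poly → ℕ → ℕ → Set
Visible P a b = ∀ t → 1 ≤ t → t < a → ¬ (eval P a ∣ b * eval P t)

module Submission where

-- If P(a) ∣ b·P(t), cancel g = gcd(P(a), P(t)): the cofactor d_t = P(a)/g divides
-- b·(P(t)/g). As d_t ∣ 𝓛_P(a) and gcd(b, 𝓛_P(a)) = 1, d_t is coprime to b, so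
-- d_t ∣ P(t)/g, i.e. P(a) ∣ P(t). This is impossible because 0 < P(t) < P(a):
-- P has nonnegative coefficients and a nonzero coefficient of positive degree.

open import Defs
open import Data.Nat using (ℕ; zero; suc; _+_; _*_; _≤_; _<_; z≤n; s≤s; s≤s⁻¹; NonZero; ≢-nonZero; >-nonZero)
open import Data.Nat.Properties
open import Data.Nat.Divisibility using (_∣_; quotient; ∣-trans; *-cancelʳ-∣; *-monoˡ-∣; ∣⇒≤)
open import Data.Nat.GCD using (gcd; gcd[m,n]∣m; gcd[m,n]∣n; gcd[m,n]≢0)
open import Data.Nat.LCM using (m∣lcm[m,n]; n∣lcm[m,n])
open import Data.Nat.Coprimality using (Coprime; gcd≡1⇒coprime; coprime-divisor)
open import Data.List using ([]; _∷_)
open import Data.Product using (_×_; _,_)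
open import Data.Sum using (inj₂)
open import Relation.Binary.PropositionalEquality using (_≡_; refl; sym; cong; trans; subst₂)
open import Relation.Nullary using (¬_; yes; no)

eval-pos : ∀ P i x → 0 < coeff P i → 0 < x → 0 < eval P x
eval-pos (c ∷ cs) zero    x ci>0 _   = ≤-trans ci>0 (m≤m+n c _)
eval-pos (c ∷ cs) (suc i) x ci>0 x>0 = ≤-trans (*-mono-≤ x>0 (eval-pos cs i x ci>0 x>0)) (m≤n+m _ c)

eval-mono-≤ : ∀ P {x y} → x ≤ y → eval P x ≤ eval P y
eval-mono-≤ []       _   = z≤n
eval-mono-≤ (c ∷ cs) x≤y = +-monoʳ-≤ c (*-mono-≤ x≤y (eval-mono-≤ cs x≤y))

eval-mono-< : ∀ P i {x y} → 1 ≤ i → 0 < coeff P i → x < y → eval P x < eval P y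
eval-mono-< (c ∷ cs) (suc i) {x} {y} _ ci>0 x<y = +-monoʳ-< c (begin-strict
  x * eval cs x  ≤⟨ *-monoʳ-≤ x (eval-mono-≤ cs (<⇒≤ x<y)) ⟩
  x * eval cs y  <⟨ *-monoˡ-< (eval cs y) {{>-nonZero (eval-pos cs i y ci>0 (≤-trans (s≤s z≤n) x<y))}} x<y ⟩
  y * eval cs y  ∎)
  where open ≤-Reasoning

cofactor : ℕ → ℕ → ℕ
cofactor m n = quotient (gcd[m,n]∣m m n)

coprime-cofactor-divisor : ∀ {m n k} → 0 < n → Coprime (cofactor m n) k → m ∣ k * n → m ∣ n
coprime-cofactor-divisor {m} {n} {k} n>0 coprime m∣kn =
  subst₂ _∣_ (sym m≡cg) (sym n≡eg) (*-monoˡ-∣ g c∣e)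
  where
  g = gcd m n
  c = cofactor m n
  e = quotient (gcd[m,n]∣n m n)
  m≡cg : m ≡ c * g
  m≡cg = _∣_.equality (gcd[m,n]∣m m n)
  n≡eg : n ≡ e * g
  n≡eg = _∣_.equality (gcd[m,n]∣n m n)
  instance
    g≢0 : NonZero g
    g≢0 = ≢-nonZero (gcd[m,n]≢0 m n (inj₂ (λ n≡0 → <-irrefl (sym n≡0) n>0)))
  c∣ke : c ∣ k * e
  c∣ke = *-cancelʳ-∣ g (subst₂ _∣_ m≡cg kn≡keg m∣kn)
    where
    kn≡keg : k * n ≡ k * e * g
    kn≡keg = trans (cong (k *_) n≡eg) (sym (*-assoc k e g))
  c∣e : c ∣ e
  c∣e = coprime-divisor coprime c∣ke

coprime-∣ʳ : ∀ {k m n} → Coprime k n → m ∣ n → Coprime m k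
coprime-∣ʳ k⊥n m∣n (i∣m , i∣k) = k⊥n (i∣k , ∣-trans i∣m m∣n)

d∣lcmUpTo : ∀ P a k t → 1 ≤ t → t ≤ k → d P a t ∣ lcmUpTo P a k
d∣lcmUpTo P a zero    zero    ()  _
d∣lcmUpTo P a zero    (suc t) _   ()
d∣lcmUpTo P a (suc k) t 1≤t t≤1+k with t ≟ suc k
... | yes refl = m∣lcm[m,n] _ _
... | no t≢1+k = ∣-trans (d∣lcmUpTo P a k t 1≤t (s≤s⁻¹ (≤∧≢⇒< t≤1+k t≢1+k))) (n∣lcm[m,n] (d P a (suc k)) _)

d∣𝓛 : ∀ P a t → 1 ≤ t → t < a → d P a t ∣ 𝓛 P a
d∣𝓛 P (suc a) t 1≤t t<1+a = d∣lcmUpTo P (suc a) a t 1≤t (s≤s⁻¹ t<1+a)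

theorem3p6 : (P : Poly) → Nonconstant P → content P ≡ 1 →
    (a b : ℕ) → 1 ≤ a → 1 ≤ b → gcd b (𝓛 P a) ≡ 1 →
    (∀ t → 1 ≤ t → t < a → ¬ (eval P a ∣ b * eval P t)) × Visible P a b
theorem3p6 P (i , 1≤i , ci>0) _ a b _ _ gcd[b,𝓛]≡1 = visible , visible
  where
  visible : Visible P a b
  visible t 1≤t t<a P[a]∣bP[t] = <⇒≱ P[t]<P[a] (∣⇒≤ {{>-nonZero P[t]>0}} P[a]∣P[t])
    where
    P[t]>0 : 0 < eval P t
    P[t]>0 = eval-pos P i t ci>0 1≤t
    P[t]<P[a] : eval P t < eval P a
    P[t]<P[a] = eval-mono-< P i 1≤i ci>0 t<a
    d⊥b : Coprime (d P a t) b
    d⊥b = coprime-∣ʳ (gcd≡1⇒coprime gcd[b,𝓛]≡1) (d∣𝓛 P a t 1≤t t<a)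
    P[a]∣P[t] : eval P a ∣ eval P t
    P[a]∣P[t] = coprime-cofactor-divisor P[t]>0 d⊥b P[a]∣bP[t]
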